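{- Let $T$ be a monad and $F$ an endofunctor on $\mathbf{Sets}$ such that: $\mathcal{K}\ell(T)$ is $\mathbf{Cppo}$-enriched with left-strict composition; there is a distributive law $\lambda\colon FT\Rightarrow TF$ whose induced lifting $\overline{F}$ is locally monotone; and $F$ preserves $\omega$-colimits. Then the empty set $\emptyset$ is both an initial and a final object in $\mathcal{K}\ell(T)$.
   Context: $\mathcal{K}\ell(T)$: objects sets, arrows $X\to Y$ functions $X\to TY$, identities $\eta_X$, composition $g\circ f=\mu_Z\circ Tg\circ f$. A distributive law $\lambda\colon FT\Rightarrow TF$ is natural with $\lambda\circ F\eta=\eta F$ and $\lambda\circ F\mu=\mu F\circ T\lambda\circ\lambda T$; its induced lifting is $\overline{F}X=FX$, $\overline{F}f=\lambda_Y\circ Ff$. $\mathbf{Cppo}$-enriched: hom-sets are partial orders with least element $\bot_{X,Y}$ in which increasing $\omega$-chains have joins, and composition preserves such joins in each argument; left-strict: $\bot\circ f=\bot$; locally monotone: $f\sqsubseteq g\Rightarrow\overline{F}f\sqsubseteq\overline{F}g$. -}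

module Defs where

open import Data.Nat using (ℕ; suc)
open import Data.Product using (Σ; _×_)
open import Data.Empty using (⊥)
open import Relation.Binary.PropositionalEquality using (_≡_)
open import Relation.Binary.Structures using (IsPartialOrder)
open import Function using (_∘_; id)

-- Sets = Agda's Set (level 0).  Equality of functions is pointwise ≡
-- (extensional equality), since Agda has no function extensionality.
_≗_ : {A B : Set} → (A → B) → (A → B) → Set
f ≗ g = ∀ x → f x ≡ g x

infix 4 _≗_

record Functor : Set₁ where
  field
    F₀     : Set → Set
    fmap   : {A B : Set} → (A → B) → F₀ A → F₀ B
    fmap-cong : {A B : Set} {f g : A → B} → f ≗ g → fmap f ≗ fmap g
    fmap-id   : {A : Set} → fmap (id {A = A}) ≗ id
    fmap-∘    : {A B C : Set} (g : B → C) (f : A → B) → fmap (g ∘ f) ≗ fmap g ∘ fmap f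

record Monad : Set₁ where
  field
    functor : Functor
  open Functor functor renaming (F₀ to T) public
  field
    η     : {A : Set} → A → T A
    μ     : {A : Set} → T (T A) → T A
    η-nat : {A B : Set} (f : A → B) → fmap f ∘ η ≗ η ∘ f
    μ-nat : {A B : Set} (f : A → B) → fmap f ∘ μ ≗ μ ∘ fmap (fmap f)
    μ-ηT  : {A : Set} → μ ∘ η {T A} ≗ id
    μ-Tη  : {A : Set} → μ ∘ fmap (η {A}) ≗ id
    μ-assoc : {A : Set} → μ ∘ μ {T A} ≗ μ ∘ fmap (μ {A})

module Kleisli (M : Monad) where
  open Monad M

  Kl : Set → Set → Set
  Kl X Y = X → T Y

  idK : {X : Set} → Kl X X
  idK = η

  _⊙_ : {X Y Z : Set} → Kl Y Z → Kl X Y → Kl X Z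
  (g ⊙ f) x = μ (fmap g (f x))

  infixr 9 _⊙_

  _≈_ : {X Y : Set} → Kl X Y → Kl X Y → Set
  f ≈ g = f ≗ g

  infix 4 _≈_

  IsInitial : Set → Set₁
  IsInitial I = (Y : Set) → Σ (Kl I Y) (λ f → (g : Kl I Y) → g ≈ f)

  IsFinal : Set → Set₁
  IsFinal Z = (X : Set) → Σ (Kl X Z) (λ f → (g : Kl X Z) → g ≈ f)

  record CppoEnriched : Set₁ where
    field
      _⊑_   : {X Y : Set} → Kl X Y → Kl X Y → Set
      isPartialOrder : {X Y : Set} → IsPartialOrder (_≈_ {X} {Y}) _⊑_
      ⊥K    : {X Y : Set} → Kl X Y
      ⊥K-least : {X Y : Set} (f : Kl X Y) → ⊥K ⊑ f

    IsChain : {X Y : Set} → (ℕ → Kl X Y) → Set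
    IsChain c = ∀ n → c n ⊑ c (suc n)

    IsLub : {X Y : Set} → (ℕ → Kl X Y) → Kl X Y → Set
    IsLub c s = (∀ n → c n ⊑ s) × ((u : _) → (∀ n → c n ⊑ u) → s ⊑ u)

    field
      ⨆     : {X Y : Set} (c : ℕ → Kl X Y) → IsChain c → Kl X Y
      ⨆-lub : {X Y : Set} (c : ℕ → Kl X Y) (p : IsChain c) → IsLub c (⨆ c p)
      ⊙-preserves-⨆ˡ : {X Y Z : Set} (g : Kl Y Z) (c : ℕ → Kl X Y) (p : IsChain c)
                       → IsLub (λ n → g ⊙ c n) (g ⊙ ⨆ c p)
      ⊙-preserves-⨆ʳ : {X Y Z : Set} (c : ℕ → Kl Y Z) (p : IsChain c) (f : Kl X Y)
                       → IsLub (λ n → c n ⊙ f) (⨆ c p ⊙ f)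

  LeftStrict : CppoEnriched → Set₁
  LeftStrict C = {X Y Z : Set} (f : Kl X Y) → CppoEnriched.⊥K C {Y} {Z} ⊙ f ≈ CppoEnriched.⊥K C

record DistributiveLaw (F : Functor) (M : Monad) : Set₁ where
  open Functor F renaming (F₀ to F₀; fmap to Fmap)
  open Monad M
  field
    λ′      : {A : Set} → F₀ (T A) → T (F₀ A)
    λ-nat   : {A B : Set} (f : A → B) → λ′ ∘ Fmap (fmap f) ≗ fmap (Fmap f) ∘ λ′
    λ-η     : {A : Set} → λ′ ∘ Fmap (η {A}) ≗ η
    λ-μ     : {A : Set} → λ′ ∘ Fmap (μ {A}) ≗ μ ∘ fmap λ′ ∘ λ′

  lift : {X Y : Set} → (X → T Y) → F₀ X → T (F₀ Y)
  lift f = λ′ ∘ Fmap f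

LocallyMonotone : {F : Functor} {M : Monad} → Kleisli.CppoEnriched M → DistributiveLaw F M → Set₁
LocallyMonotone {F} {M} C L =
  {X Y : Set} (f g : Kleisli.Kl M X Y) → f ⊑ g → DistributiveLaw.lift L f ⊑ DistributiveLaw.lift L g
  where open Kleisli.CppoEnriched C

record ωChain : Set₁ where
  field
    D : ℕ → Set
    d : (n : ℕ) → D n → D (suc n)

record Cocone (Δ : ωChain) : Set₁ where
  open ωChain Δ
  field
    apex : Set
    ι    : (n : ℕ) → D n → apex
    ι-commute : (n : ℕ) → ι (suc n) ∘ d n ≗ ι n

IsColimit : {Δ : ωChain} → Cocone Δ → Set₁
IsColimit {Δ} L =
  (K : Cocone Δ) →
  Σ (Cocone.apex L → Cocone.apex K) λ u →
    ((n : ℕ) → u ∘ Cocone.ι L n ≗ Cocone.ι K n) ×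
    ((v : Cocone.apex L → Cocone.apex K) → ((n : ℕ) → v ∘ Cocone.ι L n ≗ Cocone.ι K n) → v ≗ u)

mapChain : Functor → ωChain → ωChain
mapChain F Δ = record { D = λ n → F₀ (D n) ; d = λ n → fmap (d n) }
  where open Functor F ; open ωChain Δ

mapCocone : (F : Functor) {Δ : ωChain} → Cocone Δ → Cocone (mapChain F Δ)
mapCocone F {Δ} L = record
  { apex = F₀ apex
  ; ι = λ n → fmap (ι n)
  ; ι-commute = λ n x → trans (sym (fmap-∘ (ι (suc n)) (d n) x)) (fmap-cong (ι-commute n) x) }
  where open Functor F ; open Cocone L ; open ωChain Δ
        open import Relation.Binary.PropositionalEquality using (trans; sym)

PreservesωColimits : Functor → Set₁
PreservesωColimits F = {Δ : ωChain} (L : Cocone Δ) → IsColimit L → IsColimit (mapCocone F L)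

∅ : Set
∅ = ⊥

module Submission where

-- Initiality holds in Kl(T) for every monad: a Kleisli arrow out of ∅ is
-- a function out of the empty set, and there is exactly one such.
--
-- Finality uses only the Cppo-enrichment and left-strictness.  In general,
-- an object Z whose identity η_Z coincides with the least arrow ⊥ is final:
-- every g : X → Z factors as g = η_Z ⊙ g = ⊥ ⊙ g = ⊥ (left unit law,
-- congruence of ⊙, left-strictness).  For Z = ∅ the hom-set Kl(∅, ∅) is a
-- singleton, so η_∅ = ⊥ holds trivially.

open import Defs
open import Data.Product using (_×_; _,_)
open import Relation.Binary.PropositionalEquality using (cong; trans; sym)

from-∅-unique : {A : Set} (f g : ∅ → A) → f ≗ g
from-∅-unique f g ()

module _ (M : Monad) where
  open Monad M
  open Kleisli M

  ⊙-identityˡ : {X Y : Set} (g : Kl X Y) → idK ⊙ g ≈ g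
  ⊙-identityˡ g x = μ-Tη (g x)

  ⊙-congˡ : {X Y Z : Set} {f f′ : Kl Y Z} (g : Kl X Y) → f ≈ f′ → f ⊙ g ≈ f′ ⊙ g
  ⊙-congˡ g f≈f′ x = cong μ (fmap-cong f≈f′ (g x))

  ∅-initial : IsInitial ∅
  ∅-initial Y = (λ ()) , λ g → from-∅-unique g (λ ())

  module _ (C : CppoEnriched) (strict : LeftStrict C) where
    open CppoEnriched C using (⊥K)

    final-if-id≈⊥ : (Z : Set) → idK {Z} ≈ ⊥K → IsFinal Z
    final-if-id≈⊥ Z id≈⊥ X = ⊥K , λ g x →
      trans (sym (⊙-identityˡ g x)) (trans (⊙-congˡ g id≈⊥ x) (strict g x))

    ∅-final : IsFinal ∅
    ∅-final = final-if-id≈⊥ ∅ (from-∅-unique idK ⊥K)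

lemma3p5 : (T : Monad) (F : Functor)
           (C : Kleisli.CppoEnriched T) → Kleisli.LeftStrict T C →
           (L : DistributiveLaw F T) → LocallyMonotone C L →
           PreservesωColimits F →
           Kleisli.IsInitial T ∅ × Kleisli.IsFinal T ∅
lemma3p5 T _ C strict _ _ _ = ∅-initial T , ∅-final T C strict
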